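{- Let $\Delta$ be a simplicial complex on vertex set $[n]$ of codimension $c=n-\dim\Delta-1$. If $\Delta$ has at least $\binom{n}{c}-c$ facets of dimension $\dim\Delta=n-c-1$, then $\Delta$ is vertex decomposable.
   Context: A simplicial complex on vertex set $[n]$ contains $\{i\}$ as a face for every $i\in[n]$. $\dim F=|F|-1$, $\dim\Delta=\max\{\dim F:F\in\Delta\}$; facets are maximal faces. For a vertex $x$, $\mathrm{link}_\Delta(x)=\{G\in\Delta : x\notin G,\ G\cup\{x\}\in\Delta\}$ and $\mathrm{del}_\Delta(x)=\{G\in\Delta: x\notin G\}$. A vertex $x$ is a shedding vertex if for every facet $F$ of $\Delta$ with $x\in F$ there is a vertex $y\notin F$ such that $(F\setminus\{x\})\cup\{y\}\in\Delta$. A simplicial complex $\Delta$ is vertex decomposable if either $\Delta=\{\emptyset\}$ or $\Delta$ is a simplex (has a single facet), or there exists a shedding vertex $x$ such that both $\mathrm{link}_\Delta(x)$ and $\mathrm{del}_\Delta(x)$ are vertex decomposable. -}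

module Defs where

open import Data.Bool using (Bool; true; false; not; _∧_; _∨_; T)
open import Data.Nat using (ℕ; zero; suc; _⊔_; _≡ᵇ_; _∸_; _≤_)
open import Data.Fin using (Fin)
open import Data.Fin.Subset using (Subset; ⁅_⁆; _∈_; _∉_; _⊆_; _∪_; _-_; ∣_∣; ⊥)
open import Data.Vec using (Vec; []; _∷_; lookup)
open import Data.List using (List; []; _∷_; _++_; map; filterᵇ; length; foldr)
open import Data.Product using (Σ; _×_; ∃; _,_)
open import Relation.Binary.PropositionalEquality using (_≡_)
open import Function.Bundles using (_⇔_)

-- A (possibly non-pure, possibly void) family of faces on ground set Fin n,
-- given by its Boolean membership test. Faces are subsets of Fin n.
Complex : ℕ → Set
Complex n = Subset n → Bool

_∈Δ_ : ∀ {n} → Subset n → Complex n → Set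
F ∈Δ Δ = T (Δ F)

IsSimplicialComplexOn : ∀ n → Complex n → Set
IsSimplicialComplexOn n Δ =
  (∀ (F G : Subset n) → G ⊆ F → F ∈Δ Δ → G ∈Δ Δ)
  × (⊥ ∈Δ Δ)
  × (∀ (i : Fin n) → ⁅ i ⁆ ∈Δ Δ)

IsFacet : ∀ {n} → Complex n → Subset n → Set
IsFacet Δ F = F ∈Δ Δ × (∀ G → F ⊆ G → G ∈Δ Δ → G ≡ F)

link : ∀ {n} → Complex n → Fin n → Complex n
link Δ x G = not (lookup G x) ∧ Δ (G ∪ ⁅ x ⁆)

del : ∀ {n} → Complex n → Fin n → Complex n
del Δ x G = not (lookup G x) ∧ Δ G

IsShedding : ∀ {n} → Complex n → Fin n → Set
IsShedding Δ x =
  ∀ F → IsFacet Δ F → x ∈ F → ∃ λ y → y ∉ F × (((F - x) ∪ ⁅ y ⁆) ∈Δ Δ)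

data VertexDecomposable {n : ℕ} (Δ : Complex n) : Set where
  vd-empty   : (∀ F → F ∈Δ Δ ⇔ F ≡ ⊥) → VertexDecomposable Δ
  vd-simplex : (Σ (Subset n) λ F → IsFacet Δ F × (∀ G → IsFacet Δ G → G ≡ F))
             → VertexDecomposable Δ
  vd-shed    : (x : Fin n) → ⁅ x ⁆ ∈Δ Δ → IsShedding Δ x
             → VertexDecomposable (link Δ x) → VertexDecomposable (del Δ x)
             → VertexDecomposable Δ

allSubsets : ∀ n → List (Subset n)
allSubsets zero    = [] ∷ []
allSubsets (suc n) = map (true ∷_) (allSubsets n) ++ map (false ∷_) (allSubsets n)

_⊆ᵇ_ : ∀ {n} → Subset n → Subset n → Bool
[]      ⊆ᵇ []      = true
(a ∷ p) ⊆ᵇ (b ∷ q) = (not a ∨ b) ∧ (p ⊆ᵇ q)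

_≡ˢ_ : ∀ {n} → Subset n → Subset n → Bool
[]      ≡ˢ []      = true
(a ∷ p) ≡ˢ (b ∷ q) = ((a ∧ b) ∨ (not a ∧ not b)) ∧ (p ≡ˢ q)

allᵇ : ∀ {A : Set} → (A → Bool) → List A → Bool
allᵇ p []       = true
allᵇ p (x ∷ xs) = p x ∧ allᵇ p xs

isFacetᵇ : ∀ {n} → Complex n → Subset n → Bool
isFacetᵇ {n} Δ F = Δ F ∧ allᵇ (λ G → not ((F ⊆ᵇ G) ∧ not (G ≡ˢ F) ∧ Δ G)) (allSubsets n)

-- max cardinality of a face; dim Δ = maxFaceSize Δ - 1
maxFaceSize : ∀ {n} → Complex n → ℕ
maxFaceSize {n} Δ = foldr _⊔_ 0 (map ∣_∣ (filterᵇ Δ (allSubsets n)))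

-- codimension c = n - dim Δ - 1 = n - maxFaceSize Δ
codim : ∀ {n} → Complex n → ℕ
codim {n} Δ = n ∸ maxFaceSize Δ

numTopFacets : ∀ {n} → Complex n → ℕ
numTopFacets {n} Δ =
  length (filterᵇ (λ F → isFacetᵇ Δ F ∧ (∣ F ∣ ≡ᵇ maxFaceSize Δ)) (allSubsets n))

-- Let K be the largest face size and c = n − K. Since C(n,c) = C(n,K) and every K-face is a
-- facet, the hypothesis says that at most c of the K-subsets of [n] are missing from Δ. The
-- invariant "at most ∣V∣ − K of the K-subsets of the vertex set V are missing" forces every
-- smaller subset of V into Δ (a (K−1)-set has ∣V∣ − K + 1 one-point extensions in V, not all
-- missing), and it passes to lk x (with K − 1) and to del x on V − x, provided x lies in a
-- missing K-set whenever there is one, so that deleting x also deletes a missing set. Such an x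
-- is a shedding vertex: for a facet F ∋ x of size K, the ∣V∣ − K one-point extensions of F − x
-- in V − x cannot all be missing from del x. A vertex with {x} ∉ Δ (possible only for K = 1) is
-- just dropped from V. Induction on ∣V∣ ends in a void complex or a simplex.

module Submission where

open import Defs
open import Data.Nat using (ℕ; _∸_; _≤_)
open import Data.Nat.Combinatorics using (_C_)

open import Data.Bool using (Bool; true; false; not; _∧_; T)
open import Data.Bool.Properties using (T-∧)
import Data.Bool.Properties as Bool
open import Data.Fin using (Fin; zero; suc)
open import Data.Fin.Properties using (any?)
open import Data.Fin.Subset
  using (Subset; Nonempty; inside; outside; ⁅_⁆; _∈_; _∉_; _⊆_; _∪_; _-_; ∣_∣; ⊥; ⊤)
open import Data.Fin.Subset.Properties
open import Data.List using ([]; _∷_; _++_; map; filter; length; foldr)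
open import Data.List.Properties using (length-++; filter-++; filter-≐; filter-none; filter-some; foldr-preservesᵇ)
import Data.List.Relation.Unary.All.Properties as All
open import Data.List.Membership.Propositional using () renaming (_∈_ to _∈ₗ_)
open import Data.List.Membership.Propositional.Properties using (∈-++⁺ˡ; ∈-++⁺ʳ; ∈-map⁺; ∈-filter⁺)
import Data.List.Relation.Unary.All as All
import Data.List.Relation.Unary.Any as Any
open import Data.List.Relation.Binary.Sublist.Propositional using () renaming (⊆-refl to ⊆ₗ-refl)
open import Data.List.Relation.Binary.Sublist.Propositional.Properties using (filter⁺; length-mono-≤)
open import Data.Nat using (zero; suc; _+_; _⊔_; _<_; z≤n; s≤s; _≟_; _≡ᵇ_)
open import Data.Nat.Properties
open import Data.Nat.Combinatorics using (nCk≡nC[n∸k]; nCk+nC[k+1]≡[n+1]C[k+1])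
open import Data.Product using (∃; _×_; _,_; proj₁; proj₂)
open import Data.Sum using (inj₁; inj₂)
open import Data.Vec using ([]; _∷_; lookup; here; there)
open import Data.Vec.Properties using (≡-dec; ∷-injectiveʳ; []=⇒lookup; lookup⇒[]=)
open import Function using (_∘_; case_of_)
open import Function.Bundles using (Equivalence; mk⇔)
open import Level using (Level; 0ℓ)
open import Relation.Binary.PropositionalEquality
open import Relation.Nullary using (¬_; Dec; does; yes; no; ¬?; contradiction)
open import Relation.Nullary.Decidable using (_×-dec_; T?; decidable-stable)
open import Relation.Unary using (Pred; Decidable)
open import Relation.Unary.Properties using (_∩?_; ∁?)

private
  variable
    ℓ ℓ′ : Level
    n k : ℕ
    x : Fin n
    p q r F G H V W : Subset n
    Δ : Complex n

x∉p-x : ∀ (p : Subset n) x → x ∉ p - x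
x∉p-x (s ∷ p) zero    ()
x∉p-x (s ∷ p) (suc x) (there x∈p-x) = x∉p-x p x x∈p-x

x∈p-y⇒x≢y : ∀ {p : Subset n} {x y} → x ∈ p - y → x ≢ y
x∈p-y⇒x≢y {p = p} {y = y} x∈p-y refl = x∉p-x p y x∈p-y

p⊆q∧x∉p⇒p⊆q-x : p ⊆ q → x ∉ p → p ⊆ q - x
p⊆q∧x∉p⇒p⊆q-x p⊆q x∉p y∈p = x∈p∧x≢y⇒x∈p-y (p⊆q y∈p) (λ { refl → x∉p y∈p })

x∈p⇒⁅x⁆⊆p : x ∈ p → ⁅ x ⁆ ⊆ p
x∈p⇒⁅x⁆⊆p {x = x} x∈p y∈⁅x⁆ = subst (_∈ _) (sym (x∈⁅y⁆⇒x≡y x y∈⁅x⁆)) x∈p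

∪-lub : p ⊆ r → q ⊆ r → p ∪ q ⊆ r
∪-lub {p = p} {q = q} p⊆r q⊆r x∈p∪q with x∈p∪q⁻ p q x∈p∪q
... | inj₁ x∈p = p⊆r x∈p
... | inj₂ x∈q = q⊆r x∈q

x∈p⇒1+∣p-x∣≡∣p∣ : x ∈ p → suc ∣ p - x ∣ ≡ ∣ p ∣
x∈p⇒1+∣p-x∣≡∣p∣ {x = zero}  {p = inside ∷ p} here = cong (suc ∘ ∣_∣) (p─⊥≡p p)
x∈p⇒1+∣p-x∣≡∣p∣ {x = suc x} {p = inside  ∷ p} (there x∈p) = cong suc (x∈p⇒1+∣p-x∣≡∣p∣ x∈p)
x∈p⇒1+∣p-x∣≡∣p∣ {x = suc x} {p = outside ∷ p} (there x∈p) = x∈p⇒1+∣p-x∣≡∣p∣ x∈p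

x∈p∧∣p∣≡1+m⇒∣p-x∣≡m : ∀ {m} → x ∈ p → ∣ p ∣ ≡ suc m → ∣ p - x ∣ ≡ m
x∈p∧∣p∣≡1+m⇒∣p-x∣≡m x∈p ∣p∣≡1+m = suc-injective (trans (x∈p⇒1+∣p-x∣≡∣p∣ x∈p) ∣p∣≡1+m)

x∉p⇒∣p∪⁅x⁆∣≡1+∣p∣ : x ∉ p → ∣ p ∪ ⁅ x ⁆ ∣ ≡ suc ∣ p ∣
x∉p⇒∣p∪⁅x⁆∣≡1+∣p∣ {x = zero}  {p = inside  ∷ p} x∉p = contradiction here x∉p
x∉p⇒∣p∪⁅x⁆∣≡1+∣p∣ {x = zero}  {p = outside ∷ p} x∉p = cong (suc ∘ ∣_∣) (∪-identityʳ p)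
x∉p⇒∣p∪⁅x⁆∣≡1+∣p∣ {x = suc x} {p = inside  ∷ p} x∉p =
  cong suc (x∉p⇒∣p∪⁅x⁆∣≡1+∣p∣ (drop-not-there x∉p))
x∉p⇒∣p∪⁅x⁆∣≡1+∣p∣ {x = suc x} {p = outside ∷ p} x∉p = x∉p⇒∣p∪⁅x⁆∣≡1+∣p∣ (drop-not-there x∉p)

∣p∣<∣q∣⇒∃∈q∖p : ∣ p ∣ < ∣ q ∣ → ∃ λ x → x ∈ q × x ∉ p
∣p∣<∣q∣⇒∃∈q∖p {p = p} {q = q} ∣p∣<∣q∣ with any? (λ x → x ∈? q ×-dec ¬? (x ∈? p))
... | yes witness = witness
... | no  ∄      = contradiction (p⊆q⇒∣p∣≤∣q∣ q⊆p) (<⇒≱ ∣p∣<∣q∣)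
  where
  q⊆p : q ⊆ p
  q⊆p {x} x∈q = decidable-stable (x ∈? p) (λ x∉p → ∄ (x , x∈q , x∉p))

x∈p⇒0<∣p∣ : x ∈ p → 0 < ∣ p ∣
x∈p⇒0<∣p∣ {x = x} x∈p = subst (_≤ _) (∣⁅x⁆∣≡1 x) (p⊆q⇒∣p∣≤∣q∣ (x∈p⇒⁅x⁆⊆p x∈p))

∣p∣>0⇒Nonempty : ∀ {n} {p : Subset n} → 0 < ∣ p ∣ → Nonempty p
∣p∣>0⇒Nonempty {n = n} {p = p} 0<∣p∣
  with ∣p∣<∣q∣⇒∃∈q∖p {p = ⊥} {q = p} (subst (_< ∣ p ∣) (sym (∣⊥∣≡0 n)) 0<∣p∣)
... | x , x∈p , _ = x , x∈p

p⊆q∧∣q∣≤∣p∣⇒p≡q : p ⊆ q → ∣ q ∣ ≤ ∣ p ∣ → p ≡ q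
p⊆q∧∣q∣≤∣p∣⇒p≡q {p = p} p⊆q ∣q∣≤∣p∣ = ⊆-antisym p⊆q q⊆p
  where
  q⊆p : _ ⊆ p
  q⊆p {x} x∈q = decidable-stable (x ∈? p)
    (λ x∉p → <⇒≱ (p⊂q⇒∣p∣<∣q∣ (p⊆q , x , x∈q , x∉p)) ∣q∣≤∣p∣)

p⊆q∧∣q∣≡1+∣p∣⇒q≡p∪⁅y⁆ : p ⊆ q → ∣ q ∣ ≡ suc ∣ p ∣ → ∃ λ y → y ∉ p × q ≡ p ∪ ⁅ y ⁆
p⊆q∧∣q∣≡1+∣p∣⇒q≡p∪⁅y⁆ {p = p} {q = q} p⊆q ∣q∣≡1+∣p∣
  with ∣p∣<∣q∣⇒∃∈q∖p (≤-reflexive (sym ∣q∣≡1+∣p∣))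
... | y , y∈q , y∉p = y , y∉p , sym (p⊆q∧∣q∣≤∣p∣⇒p≡q (∪-lub p⊆q (x∈p⇒⁅x⁆⊆p y∈q))
        (≤-reflexive (trans ∣q∣≡1+∣p∣ (sym (x∉p⇒∣p∪⁅x⁆∣≡1+∣p∣ y∉p)))))

-- Counting subsets

infix 4 _≟ₛ_
_≟ₛ_ : (p q : Subset n) → Dec (p ≡ q)
_≟ₛ_ = ≡-dec Bool._≟_

∈-allSubsets : ∀ (p : Subset n) → p ∈ₗ allSubsets n
∈-allSubsets []            = Any.here refl
∈-allSubsets (inside  ∷ p) = ∈-++⁺ˡ (∈-map⁺ (inside ∷_) (∈-allSubsets p))
∈-allSubsets (outside ∷ p) = ∈-++⁺ʳ _ (∈-map⁺ (outside ∷_) (∈-allSubsets p))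

count : {P : Pred (Subset n) ℓ} → Decidable P → ℕ
count {n = n} P? = length (filter P? (allSubsets n))

module _ {A B : Set} {P : Pred B ℓ} (P? : Decidable P) where

  length-filter-map : ∀ (f : A → B) xs → length (filter P? (map f xs)) ≡ length (filter (P? ∘ f) xs)
  length-filter-map f []       = refl
  length-filter-map f (x ∷ xs) with does (P? (f x))
  ... | true  = cong suc (length-filter-map f xs)
  ... | false = length-filter-map f xs

module _ {A : Set} {P : Pred A ℓ} {Q : Pred A ℓ′} (P? : Decidable P) (Q? : Decidable Q) where

  length-filter-split : ∀ xs →
    length (filter P? xs) ≡ length (filter (P? ∩? Q?) xs) + length (filter (P? ∩? ∁? Q?) xs)
  length-filter-split []       = refl
  length-filter-split (x ∷ xs) with P? x | Q? x
  ... | yes _ | yes _ = cong suc (length-filter-split xs)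
  ... | yes _ | no  _ = trans (cong suc (length-filter-split xs)) (sym (+-suc _ _))
  ... | no  _ | _     = length-filter-split xs

module _ {P : Pred (Subset n) ℓ} (P? : Decidable P) where

  count-none : (∀ p → ¬ P p) → count P? ≡ 0
  count-none ∄ = cong length (filter-none P? (All.universal ∄ (allSubsets n)))

  count-pos : P p → 0 < count P?
  count-pos {p = p} Pp = filter-some P? (Any.map (λ { refl → Pp }) (∈-allSubsets p))

  module _ {Q : Pred (Subset n) ℓ′} (Q? : Decidable Q) where

    count-mono : (∀ {p} → P p → Q p) → count P? ≤ count Q?
    count-mono P⊆Q = length-mono-≤ (filter⁺ P? Q? (λ { refl → P⊆Q }) (⊆ₗ-refl {x = allSubsets n}))

    count-cong : (∀ {p} → P p → Q p) → (∀ {p} → Q p → P p) → count P? ≡ count Q?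
    count-cong P⊆Q Q⊆P = cong length (filter-≐ P? Q? (P⊆Q , Q⊆P) (allSubsets n))

    count-split : count P? ≡ count (P? ∩? Q?) + count (P? ∩? ∁? Q?)
    count-split = length-filter-split P? Q? (allSubsets n)

count-∷ : {P : Pred (Subset (suc n)) ℓ} (P? : Decidable P) →
          count P? ≡ count (P? ∘ (inside ∷_)) + count (P? ∘ (outside ∷_))
count-∷ {n = n} P? = begin
  length (filter P? (map (inside ∷_) subsets ++ map (outside ∷_) subsets))
    ≡⟨ cong length (filter-++ P? (map (inside ∷_) subsets) _) ⟩
  length (filter P? (map (inside ∷_) subsets) ++ filter P? (map (outside ∷_) subsets))
    ≡⟨ length-++ (filter P? (map (inside ∷_) subsets)) ⟩
  length (filter P? (map (inside ∷_) subsets)) + length (filter P? (map (outside ∷_) subsets))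
    ≡⟨ cong₂ _+_ (length-filter-map P? (inside ∷_) subsets) (length-filter-map P? (outside ∷_) subsets) ⟩
  count (P? ∘ (inside ∷_)) + count (P? ∘ (outside ∷_)) ∎
  where
  open ≡-Reasoning
  subsets = allSubsets n

count-≡ : ∀ (q : Subset n) → count (_≟ₛ q) ≡ 1
count-≡ []            = refl
count-≡ (inside ∷ q)  = begin
  count (_≟ₛ (inside ∷ q))                             ≡⟨ count-∷ (_≟ₛ (inside ∷ q)) ⟩
  count (λ p → inside ∷ p ≟ₛ inside ∷ q) + count (λ p → outside ∷ p ≟ₛ inside ∷ q)
    ≡⟨ cong₂ _+_ (count-cong _ (_≟ₛ q) ∷-injectiveʳ (cong (inside ∷_)))
                 (count-none (λ p → outside ∷ p ≟ₛ inside ∷ q) (λ _ ())) ⟩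
  count (_≟ₛ q) + 0                                    ≡⟨ +-identityʳ _ ⟩
  count (_≟ₛ q)                                        ≡⟨ count-≡ q ⟩
  1                                                    ∎
  where open ≡-Reasoning
count-≡ (outside ∷ q) = begin
  count (_≟ₛ (outside ∷ q))                            ≡⟨ count-∷ (_≟ₛ (outside ∷ q)) ⟩
  count (λ p → inside ∷ p ≟ₛ outside ∷ q) + count (λ p → outside ∷ p ≟ₛ outside ∷ q)
    ≡⟨ cong (count (λ p → inside ∷ p ≟ₛ outside ∷ q) +_)
            (count-cong _ (_≟ₛ q) ∷-injectiveʳ (cong (outside ∷_))) ⟩
  count (λ p → inside ∷ p ≟ₛ outside ∷ q) + count (_≟ₛ q)
    ≡⟨ cong₂ _+_ (count-none (λ p → inside ∷ p ≟ₛ outside ∷ q) (λ _ ())) (count-≡ q) ⟩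
  1                                                    ∎
  where open ≡-Reasoning

count-< : {P : Pred (Subset n) ℓ} {Q : Pred (Subset n) ℓ′} (P? : Decidable P) (Q? : Decidable Q) →
          (∀ {p} → P p → Q p) → Q q → ¬ P q → count P? < count Q?
count-< {q = q} {P = P} {Q = Q} P? Q? P⊆Q Qq ¬Pq = begin-strict
  count P?                                         <⟨ s≤s (count-mono P? (Q? ∩? ∁? (_≟ₛ q)) P⊆Q∖q) ⟩
  1 + count (Q? ∩? ∁? (_≟ₛ q))                     ≡⟨ cong (_+ count (Q? ∩? ∁? (_≟ₛ q))) (sym count-Q∩q) ⟩
  count (Q? ∩? (_≟ₛ q)) + count (Q? ∩? ∁? (_≟ₛ q)) ≡⟨ count-split Q? (_≟ₛ q) ⟨
  count Q?                                         ∎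
  where
  open ≤-Reasoning
  P⊆Q∖q : ∀ {p} → P p → Q p × p ≢ q
  P⊆Q∖q Pp = P⊆Q Pp , λ { refl → ¬Pq Pp }
  count-Q∩q : count (Q? ∩? (_≟ₛ q)) ≡ 1
  count-Q∩q = trans (count-cong (Q? ∩? (_≟ₛ q)) (_≟ₛ q) proj₂ (λ { refl → Qq , refl })) (count-≡ q)

count-≤-insert : {P : Pred (Subset n) ℓ} {Q : Pred (Subset n) ℓ′} (P? : Decidable P) (Q? : Decidable Q) →
                 ∀ x → (∀ {p} → P p → x ∉ p × Q (p ∪ ⁅ x ⁆)) → count P? ≤ count Q?
count-≤-insert {n = suc n} {P = P} {Q = Q} P? Q? zero h = begin
  count P?                                               ≡⟨ count-∷ P? ⟩
  count (P? ∘ (inside ∷_)) + count (P? ∘ (outside ∷_))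
    ≡⟨ cong (_+ count (P? ∘ (outside ∷_))) (count-none (P? ∘ (inside ∷_)) (λ _ P1p → proj₁ (h P1p) here)) ⟩
  count (P? ∘ (outside ∷_))                              ≤⟨ count-mono (P? ∘ (outside ∷_)) (Q? ∘ (inside ∷_)) insert-zero ⟩
  count (Q? ∘ (inside ∷_))                               ≤⟨ m≤m+n _ _ ⟩
  count (Q? ∘ (inside ∷_)) + count (Q? ∘ (outside ∷_))   ≡⟨ count-∷ Q? ⟨
  count Q?                                               ∎
  where
  open ≤-Reasoning
  insert-zero : ∀ {p} → P (outside ∷ p) → Q (inside ∷ p)
  insert-zero {p} P0p = subst (Q ∘ (inside ∷_)) (∪-identityʳ p) (proj₂ (h P0p))
count-≤-insert {n = suc n} {P = P} {Q = Q} P? Q? (suc x) h = begin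
  count P?                                               ≡⟨ count-∷ P? ⟩
  count (P? ∘ (inside ∷_)) + count (P? ∘ (outside ∷_))
    ≤⟨ +-mono-≤ (count-≤-insert (P? ∘ (inside ∷_)) (Q? ∘ (inside ∷_)) x (lift ∘ h))
                (count-≤-insert (P? ∘ (outside ∷_)) (Q? ∘ (outside ∷_)) x (lift ∘ h)) ⟩
  count (Q? ∘ (inside ∷_)) + count (Q? ∘ (outside ∷_))   ≡⟨ count-∷ Q? ⟨
  count Q?                                               ∎
  where
  open ≤-Reasoning
  lift : ∀ {s p} → suc x ∉ s ∷ p × Q ((s ∷ p) ∪ ⁅ suc x ⁆) → x ∉ p × Q ((s ∷ p) ∪ ⁅ suc x ⁆)
  lift (x∉sp , Qsp) = drop-not-there x∉sp , Qsp

hasSize? : ∀ k → Decidable (λ (p : Subset n) → ∣ p ∣ ≡ k)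
hasSize? k p = ∣ p ∣ ≟ k

count-hasSize : ∀ n k → count (hasSize? {n = n} k) ≡ n C k
count-hasSize zero    zero    = refl
count-hasSize zero    (suc k) = refl
count-hasSize (suc n) zero    = begin
  count (size⁺? 0)                                                       ≡⟨ count-∷ (size⁺? 0) ⟩
  count (size⁺? 0 ∘ (inside ∷_)) + count (size⁺? 0 ∘ (outside ∷_))
    ≡⟨ cong (_+ count (size? 0)) (count-none (size⁺? 0 ∘ (inside ∷_)) (λ _ ())) ⟩
  count (size? 0)                                                        ≡⟨ count-hasSize n zero ⟩
  n C 0                                                                  ∎
  where
  open ≡-Reasoning
  size? = hasSize? {n = n}
  size⁺? = hasSize? {n = suc n}
count-hasSize (suc n) (suc k) = begin
  count (size⁺? (suc k))                                                 ≡⟨ count-∷ (size⁺? (suc k)) ⟩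
  count (size⁺? (suc k) ∘ (inside ∷_)) + count (size⁺? (suc k) ∘ (outside ∷_))
    ≡⟨ cong (_+ count (size? (suc k)))
            (count-cong (size⁺? (suc k) ∘ (inside ∷_)) (size? k) suc-injective (cong suc)) ⟩
  count (size? k) + count (size? (suc k))                                ≡⟨ cong₂ _+_ (count-hasSize n k) (count-hasSize n (suc k)) ⟩
  n C k + n C suc k                                                      ≡⟨ nCk+nC[k+1]≡[n+1]C[k+1] n k ⟩
  suc n C suc k                                                          ∎
  where
  open ≡-Reasoning
  size? = hasSize? {n = n}
  size⁺? = hasSize? {n = suc n}

Cover : Subset n → Subset n → Pred (Subset n) 0ℓ
Cover W H G = G ⊆ W × H ⊆ G × ∣ G ∣ ≡ suc ∣ H ∣

cover? : (W H : Subset n) → Decidable (Cover W H)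
cover? W H G = G ⊆? W ×-dec H ⊆? G ×-dec ∣ G ∣ ≟ suc ∣ H ∣

count-cover-outside : ∀ {s} → count (cover? (s ∷ W) (outside ∷ H) ∘ (outside ∷_)) ≡ count (cover? W H)
count-cover-outside {W = W} {H = H} {s} = count-cong (cover? (s ∷ W) (outside ∷ H) ∘ (outside ∷_)) (cover? W H)
  (λ (G⊆W , H⊆G , ∣G∣≡) → drop-∷-⊆ G⊆W , drop-∷-⊆ H⊆G , ∣G∣≡)
  (λ (G⊆W , H⊆G , ∣G∣≡) → out⊆ G⊆W , out⊆ H⊆G , ∣G∣≡)

count-cover-inside : count (cover? (inside ∷ W) (inside ∷ H) ∘ (inside ∷_)) ≡ count (cover? W H)
count-cover-inside {W = W} {H = H} = count-cong (cover? (inside ∷ W) (inside ∷ H) ∘ (inside ∷_)) (cover? W H)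
  (λ (G⊆W , H⊆G , ∣G∣≡) → drop-∷-⊆ G⊆W , drop-∷-⊆ H⊆G , suc-injective ∣G∣≡)
  (λ (G⊆W , H⊆G , ∣G∣≡) → in⊆in G⊆W , in⊆in H⊆G , cong suc ∣G∣≡)

count-cover-new : H ⊆ W → count (cover? (inside ∷ W) (outside ∷ H) ∘ (inside ∷_)) ≡ 1
count-cover-new {H = H} {W = W} H⊆W = trans
  (count-cong (cover? (inside ∷ W) (outside ∷ H) ∘ (inside ∷_)) (_≟ₛ H)
    (λ (_ , H⊆G , ∣G∣≡) → sym (p⊆q∧∣q∣≤∣p∣⇒p≡q (drop-∷-⊆ H⊆G) (≤-reflexive (suc-injective ∣G∣≡))))
    (λ { refl → in⊆in H⊆W , out⊆ ⊆-refl , refl }))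
  (count-≡ H)

count-covers : H ⊆ W → count (cover? W H) + ∣ H ∣ ≡ ∣ W ∣
count-covers {H = []} {W = []} _ = refl
count-covers {H = inside ∷ H} {W = outside ∷ W} H⊆W = case H⊆W here of λ ()
count-covers {H = inside ∷ H} {W = inside ∷ W} H⊆W = begin
  count c? + suc ∣ H ∣                                               ≡⟨ cong (_+ suc ∣ H ∣) (count-∷ c?) ⟩
  (count (c? ∘ (inside ∷_)) + count (c? ∘ (outside ∷_))) + suc ∣ H ∣
    ≡⟨ cong (_+ suc ∣ H ∣) (cong₂ _+_ (count-cover-inside {W = W} {H = H})
         (count-none (c? ∘ (outside ∷_)) (λ _ (_ , H⊆G , _) → case H⊆G here of λ ()))) ⟩
  (count (cover? W H) + 0) + suc ∣ H ∣                               ≡⟨ cong (_+ suc ∣ H ∣) (+-identityʳ _) ⟩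
  count (cover? W H) + suc ∣ H ∣                                     ≡⟨ +-suc _ ∣ H ∣ ⟩
  suc (count (cover? W H) + ∣ H ∣)                                   ≡⟨ cong suc (count-covers (drop-∷-⊆ H⊆W)) ⟩
  suc ∣ W ∣                                                          ∎
  where
  open ≡-Reasoning
  c? = cover? (inside ∷ W) (inside ∷ H)
count-covers {H = outside ∷ H} {W = inside ∷ W} H⊆W = begin
  count c? + ∣ H ∣                                                   ≡⟨ cong (_+ ∣ H ∣) (count-∷ c?) ⟩
  (count (c? ∘ (inside ∷_)) + count (c? ∘ (outside ∷_))) + ∣ H ∣
    ≡⟨ cong (_+ ∣ H ∣) (cong₂ _+_ (count-cover-new (drop-∷-⊆ H⊆W)) (count-cover-outside {W = W} {H = H})) ⟩
  suc (count (cover? W H) + ∣ H ∣)                                   ≡⟨ cong suc (count-covers (drop-∷-⊆ H⊆W)) ⟩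
  suc ∣ W ∣                                                          ∎
  where
  open ≡-Reasoning
  c? = cover? (inside ∷ W) (outside ∷ H)
count-covers {H = outside ∷ H} {W = outside ∷ W} H⊆W = begin
  count c? + ∣ H ∣                                                   ≡⟨ cong (_+ ∣ H ∣) (count-∷ c?) ⟩
  (count (c? ∘ (inside ∷_)) + count (c? ∘ (outside ∷_))) + ∣ H ∣
    ≡⟨ cong (_+ ∣ H ∣) (cong₂ _+_
         (count-none (c? ∘ (inside ∷_)) (λ _ (G⊆W , _) → case G⊆W here of λ ()))
         (count-cover-outside {W = W} {H = H})) ⟩
  count (cover? W H) + ∣ H ∣                                         ≡⟨ count-covers (drop-∷-⊆ H⊆W) ⟩
  ∣ W ∣                                                              ∎
  where
  open ≡-Reasoning
  c? = cover? (outside ∷ W) (outside ∷ H)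

not-lookup-∧⁺ : ∀ {b} → x ∉ p → T b → T (not (lookup p x) ∧ b)
not-lookup-∧⁺ {x = x} {p = p} x∉p Tb with lookup p x in eq
... | false = Tb
... | true  = contradiction (lookup⇒[]= x p eq) x∉p

not-lookup-∧⁻ : ∀ {b} → T (not (lookup p x) ∧ b) → x ∉ p × T b
not-lookup-∧⁻ {p = p} {x = x} t with lookup p x in eq
... | false = (λ x∈p → case trans (sym ([]=⇒lookup x∈p)) eq of λ ()) , t

module _ (Δ : Complex n) (x : Fin n) where

  ∈link⁺ : x ∉ G → (G ∪ ⁅ x ⁆) ∈Δ Δ → G ∈Δ link Δ x
  ∈link⁺ = not-lookup-∧⁺

  ∈link⁻ : ∀ G → G ∈Δ link Δ x → x ∉ G × (G ∪ ⁅ x ⁆) ∈Δ Δ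
  ∈link⁻ G = not-lookup-∧⁻ {p = G}

  ∈del⁺ : x ∉ G → G ∈Δ Δ → G ∈Δ del Δ x
  ∈del⁺ = not-lookup-∧⁺

  ∈del⁻ : ∀ G → G ∈Δ del Δ x → x ∉ G × G ∈Δ Δ
  ∈del⁻ G = not-lookup-∧⁻ {p = G}

-- Complexes with few missing faces

Missing : Subset n → ℕ → Complex n → Pred (Subset n) 0ℓ
Missing V k Δ G = G ⊆ V × ∣ G ∣ ≡ k × ¬ G ∈Δ Δ

missing? : (V : Subset n) (k : ℕ) (Δ : Complex n) → Decidable (Missing V k Δ)
missing? V k Δ G = G ⊆? V ×-dec ∣ G ∣ ≟ k ×-dec ¬? (T? (Δ G))

#missing : Subset n → ℕ → Complex n → ℕ
#missing V k Δ = count (missing? V k Δ)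

-- Δ is the (k−1)-skeleton of the simplex on V with at most ∣V∣ − k of its k-faces removed; the
-- skeleton is not a field since it follows from the bound (full-below).
record FewMissingFaces (V : Subset n) (k : ℕ) (Δ : Complex n) : Set where
  field
    downClosed : ∀ {F G} → G ⊆ F → F ∈Δ Δ → G ∈Δ Δ
    ∅∈Δ        : ⊥ ∈Δ Δ
    faces⊆V    : G ∈Δ Δ → G ⊆ V
    faces≤k    : G ∈Δ Δ → ∣ G ∣ ≤ k
    fewMissing : #missing V k Δ + k ≤ ∣ V ∣

module FewMissingFacesProperties {V : Subset n} {k : ℕ} {Δ : Complex n} (I : FewMissingFaces V k Δ) where
  open FewMissingFaces I

  k≤∣V∣ : k ≤ ∣ V ∣
  k≤∣V∣ = m+n≤o⇒n≤o (#missing V k Δ) fewMissing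

  -- Some cover of H is a face: otherwise all ∣V∣ − ∣H∣ covers would be missing.
  cover-face : H ⊆ V → suc ∣ H ∣ ≡ k → ∃ λ y → y ∈ V × y ∉ H × (H ∪ ⁅ y ⁆) ∈Δ Δ
  cover-face {H = H} H⊆V 1+∣H∣≡k with anySubset? (cover? V H ∩? (T? ∘ Δ))
  ... | yes (G , (G⊆V , H⊆G , ∣G∣≡) , G∈Δ) with p⊆q∧∣q∣≡1+∣p∣⇒q≡p∪⁅y⁆ H⊆G ∣G∣≡
  ...   | y , y∉H , refl = y , G⊆V (q⊆p∪q H ⁅ y ⁆ (x∈⁅x⁆ y)) , y∉H , G∈Δ
  cover-face {H = H} H⊆V 1+∣H∣≡k | no ∄ = contradiction fewMissing (<⇒≱ too-many)
    where
    cover⇒missing : ∀ {G} → Cover V H G → Missing V k Δ G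
    cover⇒missing {G} c@(G⊆V , _ , ∣G∣≡) = G⊆V , trans ∣G∣≡ 1+∣H∣≡k , λ G∈Δ → ∄ (G , c , G∈Δ)
    too-many : ∣ V ∣ < #missing V k Δ + k
    too-many = begin-strict
      ∣ V ∣                      ≡⟨ count-covers H⊆V ⟨
      count (cover? V H) + ∣ H ∣ ≤⟨ +-monoˡ-≤ ∣ H ∣ (count-mono (cover? V H) (missing? V k Δ) cover⇒missing) ⟩
      #missing V k Δ + ∣ H ∣     <⟨ +-monoʳ-< (#missing V k Δ) (≤-reflexive 1+∣H∣≡k) ⟩
      #missing V k Δ + k         ∎
      where open ≤-Reasoning

  full-below : H ⊆ V → ∣ H ∣ < k → H ∈Δ Δ
  full-below {H = H} H⊆V ∣H∣<k = extend (k ∸ suc ∣ H ∣) H⊆V (m+[n∸m]≡n ∣H∣<k)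
    where
    extend : ∀ d {H} → H ⊆ V → suc ∣ H ∣ + d ≡ k → H ∈Δ Δ
    extend zero {H} H⊆V e with cover-face H⊆V (trans (sym (+-identityʳ (suc ∣ H ∣))) e)
    ... | y , _ , _ , H∪y∈Δ = downClosed (p⊆p∪q ⁅ y ⁆) H∪y∈Δ
    extend (suc d) {H} H⊆V e
      with ∣p∣<∣q∣⇒∃∈q∖p {p = H} (≤-trans (m+n≤o⇒m≤o (suc ∣ H ∣) (≤-reflexive e)) k≤∣V∣)
    ... | y , y∈V , y∉H = downClosed (p⊆p∪q ⁅ y ⁆) (extend d (∪-lub H⊆V (x∈p⇒⁅x⁆⊆p y∈V))
          (trans (cong (λ m → suc m + d) (x∉p⇒∣p∪⁅x⁆∣≡1+∣p∣ {p = H} y∉H))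
                 (trans (sym (+-suc (suc ∣ H ∣) d)) e)))

open FewMissingFacesProperties

shrink-bound : ∀ {m} → x ∈ V → m + suc k ≤ ∣ V ∣ → m + k ≤ ∣ V - x ∣
shrink-bound {x = x} {V = V} {k = k} {m = m} x∈V m+1+k≤∣V∣ = ≤-pred (begin
  suc (m + k)   ≡⟨ +-suc m k ⟨
  m + suc k     ≤⟨ m+1+k≤∣V∣ ⟩
  ∣ V ∣         ≡⟨ x∈p⇒1+∣p-x∣≡∣p∣ x∈V ⟨
  suc ∣ V - x ∣ ∎)
  where open ≤-Reasoning

fewer-missing-bound : ∀ {a b} → a < b → b + k ≤ ∣ V ∣ → a + suc k ≤ ∣ V ∣
fewer-missing-bound {k = k} {a = a} a<b b+k≤∣V∣ =
  ≤-trans (≤-reflexive (+-suc a k)) (≤-trans (+-monoˡ-≤ k a<b) b+k≤∣V∣)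

fewMissingFaces-removeNonVertex : FewMissingFaces V k Δ → 0 < k → x ∈ V → ¬ ⁅ x ⁆ ∈Δ Δ →
                                  FewMissingFaces (V - x) k Δ
fewMissingFaces-removeNonVertex {V = V} {k = k} {Δ = Δ} {x = x} I 0<k x∈V ⁅x⁆∉Δ = record
  { downClosed = downClosed
  ; ∅∈Δ        = ∅∈Δ
  ; faces⊆V    = λ G∈Δ → p⊆q∧x∉p⇒p⊆q-x (faces⊆V G∈Δ)
                   (λ x∈G → ⁅x⁆∉Δ (downClosed (x∈p⇒⁅x⁆⊆p x∈G) G∈Δ))
  ; faces≤k    = faces≤k
  ; fewMissing = shrink-bound x∈V (fewer-missing-bound {V = V}
      (count-< (missing? (V - x) k Δ) (missing? V k Δ)
        (λ (G⊆V-x , ∣G∣≡k , G∉Δ) → ⊆-trans G⊆V-x (p─q⊆p V ⁅ x ⁆) , ∣G∣≡k , G∉Δ)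
        (x∈p⇒⁅x⁆⊆p x∈V , ∣⁅x⁆∣≡k , ⁅x⁆∉Δ)
        (λ (⁅x⁆⊆V-x , _) → x∉p-x V x (⁅x⁆⊆V-x (x∈⁅x⁆ x))))
      fewMissing)
  }
  where
  open FewMissingFaces I
  ∣⁅x⁆∣≡k : ∣ ⁅ x ⁆ ∣ ≡ k
  ∣⁅x⁆∣≡k = trans (∣⁅x⁆∣≡1 x) (≤-antisym 0<k (≮⇒≥ λ 1<k →
    ⁅x⁆∉Δ (full-below I (x∈p⇒⁅x⁆⊆p x∈V) (subst (_< k) (sym (∣⁅x⁆∣≡1 x)) 1<k))))

fewMissingFaces-link : FewMissingFaces V (suc k) Δ → x ∈ V → ⁅ x ⁆ ∈Δ Δ → FewMissingFaces (V - x) k (link Δ x)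
fewMissingFaces-link {V = V} {k = k} {Δ = Δ} {x = x} I x∈V ⁅x⁆∈Δ = record
  { downClosed = λ {F} G⊆F F∈link → let (x∉F , F∪x∈Δ) = ∈link⁻ Δ x F F∈link in
      ∈link⁺ Δ x (x∉F ∘ G⊆F) (downClosed (∪-lub (⊆-trans G⊆F (p⊆p∪q ⁅ x ⁆)) (q⊆p∪q _ ⁅ x ⁆)) F∪x∈Δ)
  ; ∅∈Δ        = ∈link⁺ Δ x ∉⊥ (subst (_∈Δ Δ) (sym (∪-identityˡ ⁅ x ⁆)) ⁅x⁆∈Δ)
  ; faces⊆V    = λ {G} G∈link → let (x∉G , G∪x∈Δ) = ∈link⁻ Δ x G G∈link in
      p⊆q∧x∉p⇒p⊆q-x (⊆-trans (p⊆p∪q ⁅ x ⁆) (faces⊆V G∪x∈Δ)) x∉G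
  ; faces≤k    = λ {G} G∈link → let (x∉G , G∪x∈Δ) = ∈link⁻ Δ x G G∈link in
      ≤-pred (subst (_≤ suc k) (x∉p⇒∣p∪⁅x⁆∣≡1+∣p∣ x∉G) (faces≤k G∪x∈Δ))
  ; fewMissing = shrink-bound x∈V (≤-trans (+-monoˡ-≤ (suc k)
      (count-≤-insert (missing? (V - x) k (link Δ x)) (missing? V (suc k) Δ) x link-missing)) fewMissing)
  }
  where
  open FewMissingFaces I
  link-missing : Missing (V - x) k (link Δ x) G → x ∉ G × Missing V (suc k) Δ (G ∪ ⁅ x ⁆)
  link-missing {G = G} (G⊆V-x , ∣G∣≡k , G∉link) =
    x∉G , ∪-lub (⊆-trans G⊆V-x (p─q⊆p V ⁅ x ⁆)) (x∈p⇒⁅x⁆⊆p x∈V) ,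
    trans (x∉p⇒∣p∪⁅x⁆∣≡1+∣p∣ x∉G) (cong suc ∣G∣≡k) , G∉link ∘ ∈link⁺ Δ x x∉G
    where
    x∉G : x ∉ G
    x∉G = x∉p-x V x ∘ G⊆V-x

fewMissingFaces-del : FewMissingFaces V k Δ → x ∈ V → #missing (V - x) k (del Δ x) + suc k ≤ ∣ V ∣ →
                     FewMissingFaces (V - x) k (del Δ x)
fewMissingFaces-del {Δ = Δ} {x = x} I x∈V bound = record
  { downClosed = λ {F} G⊆F F∈del → let (x∉F , F∈Δ) = ∈del⁻ Δ x F F∈del in
      ∈del⁺ Δ x (x∉F ∘ G⊆F) (downClosed G⊆F F∈Δ)
  ; ∅∈Δ        = ∈del⁺ Δ x ∉⊥ ∅∈Δ
  ; faces⊆V    = λ {G} G∈del → let (x∉G , G∈Δ) = ∈del⁻ Δ x G G∈del in p⊆q∧x∉p⇒p⊆q-x (faces⊆V G∈Δ) x∉G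
  ; faces≤k    = λ {G} → faces≤k ∘ proj₂ ∘ ∈del⁻ Δ x G
  ; fewMissing = shrink-bound x∈V bound
  }
  where open FewMissingFaces I

del-missing⇒missing : ∀ V x → Missing (V - x) k (del Δ x) G → Missing V k Δ G
del-missing⇒missing {Δ = Δ} V x (G⊆V-x , ∣G∣≡k , G∉del) =
  ⊆-trans G⊆V-x (p─q⊆p V ⁅ x ⁆) , ∣G∣≡k , G∉del ∘ ∈del⁺ Δ x (x∉p-x V x ∘ G⊆V-x)

-- Deleting a vertex of a missing k-face, if there is one, strictly lowers the number of missing faces.
∃fewMissingFaces-del : FewMissingFaces V k Δ → 0 < k → k < ∣ V ∣ →
               ∃ λ x → x ∈ V × FewMissingFaces (V - x) k (del Δ x)
∃fewMissingFaces-del {V = V} {k = k} {Δ = Δ} I 0<k k<∣V∣ with anySubset? (missing? V k Δ)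
... | yes (N , N-missing@(N⊆V , ∣N∣≡k , _)) with ∣p∣>0⇒Nonempty (subst (0 <_) (sym ∣N∣≡k) 0<k)
...   | x , x∈N = x , N⊆V x∈N , fewMissingFaces-del I (N⊆V x∈N) (fewer-missing-bound {V = V}
          (count-< (missing? (V - x) k (del Δ x)) (missing? V k Δ) (del-missing⇒missing {Δ = Δ} V x) N-missing
            (λ (N⊆V-x , _) → x∉p-x V x (N⊆V-x x∈N)))
          (FewMissingFaces.fewMissing I))
∃fewMissingFaces-del {V = V} {k = k} {Δ = Δ} I 0<k k<∣V∣ | no ∄ with ∣p∣>0⇒Nonempty (≤-trans 0<k (<⇒≤ k<∣V∣))
... | x , x∈V = x , x∈V , fewMissingFaces-del I x∈V (begin
      #missing (V - x) k (del Δ x) + suc k ≤⟨ +-monoˡ-≤ (suc k) (≤-trans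
        (count-mono (missing? (V - x) k (del Δ x)) (missing? V k Δ) (del-missing⇒missing {Δ = Δ} V x))
        (≤-reflexive (count-none (missing? V k Δ) (λ G G-missing → ∄ (G , G-missing))))) ⟩
      suc k                                  ≤⟨ k<∣V∣ ⟩
      ∣ V ∣                                  ∎)
  where open ≤-Reasoning

exchange-below : FewMissingFaces V k Δ → F ∈Δ Δ → x ∈ F → ∣ F ∣ < k →
                 ∃ λ y → y ∉ F × ((F - x) ∪ ⁅ y ⁆) ∈Δ Δ
exchange-below {V = V} {k = k} {F = F} {x = x} I F∈Δ x∈F ∣F∣<k
  with ∣p∣<∣q∣⇒∃∈q∖p (≤-trans ∣F∣<k (k≤∣V∣ I))
... | y , y∈V , y∉F = y , y∉F , full-below I F-x∪y⊆V (begin-strict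
      ∣ (F - x) ∪ ⁅ y ⁆ ∣ ≡⟨ x∉p⇒∣p∪⁅x⁆∣≡1+∣p∣ (y∉F ∘ p─q⊆p F ⁅ x ⁆) ⟩
      suc ∣ F - x ∣       ≡⟨ x∈p⇒1+∣p-x∣≡∣p∣ x∈F ⟩
      ∣ F ∣               <⟨ ∣F∣<k ⟩
      k                   ∎)
  where
  open ≤-Reasoning
  F-x∪y⊆V : (F - x) ∪ ⁅ y ⁆ ⊆ V
  F-x∪y⊆V = ∪-lub (⊆-trans (p─q⊆p F ⁅ x ⁆) (FewMissingFaces.faces⊆V I F∈Δ)) (x∈p⇒⁅x⁆⊆p y∈V)

exchange-top : FewMissingFaces (V - x) k (del Δ x) → F ⊆ V → x ∈ F → ∣ F ∣ ≡ k →
               ∃ λ y → y ∉ F × ((F - x) ∪ ⁅ y ⁆) ∈Δ Δ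
exchange-top {x = x} {Δ = Δ} {F = F} D F⊆V x∈F ∣F∣≡k
  with cover-face D (p⊆q∧x∉p⇒p⊆q-x (⊆-trans (p─q⊆p F ⁅ x ⁆) F⊆V) (x∉p-x F x))
                    (trans (x∈p⇒1+∣p-x∣≡∣p∣ x∈F) ∣F∣≡k)
... | y , y∈V-x , y∉F-x , F-x∪y∈del = y , y∉F , proj₂ (∈del⁻ Δ x _ F-x∪y∈del)
  where
  y∉F : y ∉ F
  y∉F y∈F = y∉F-x (x∈p∧x≢y⇒x∈p-y y∈F (x∈p-y⇒x≢y y∈V-x))

shedding : FewMissingFaces V k Δ → FewMissingFaces (V - x) k (del Δ x) → IsShedding Δ x
shedding I D F (F∈Δ , _) x∈F with m≤n⇒m<n∨m≡n (FewMissingFaces.faces≤k I F∈Δ)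
... | inj₁ ∣F∣<k = exchange-below I F∈Δ x∈F ∣F∣<k
... | inj₂ ∣F∣≡k = exchange-top D (FewMissingFaces.faces⊆V I F∈Δ) x∈F ∣F∣≡k

vertexDecomposable-rank0 : FewMissingFaces V 0 Δ → VertexDecomposable Δ
vertexDecomposable-rank0 I = vd-empty λ F → mk⇔
  (λ F∈Δ → Empty-unique (λ (x , x∈F) → <⇒≱ (x∈p⇒0<∣p∣ x∈F) (faces≤k F∈Δ)))
  (λ { refl → ∅∈Δ })
  where open FewMissingFaces I

vertexDecomposable-simplex : FewMissingFaces V k Δ → ∣ V ∣ ≡ k → VertexDecomposable Δ
vertexDecomposable-simplex {V = V} {k = k} {Δ = Δ} I ∣V∣≡k =
  vd-simplex (V , (V∈Δ , λ G V⊆G G∈Δ → ⊆-antisym (faces⊆V G∈Δ) V⊆G) ,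
              λ G (G∈Δ , maximal) → sym (maximal V (faces⊆V G∈Δ) V∈Δ))
  where
  open FewMissingFaces I
  nothing-missing : #missing V k Δ ≤ 0
  nothing-missing = +-cancelʳ-≤ k (#missing V k Δ) 0 (subst (#missing V k Δ + k ≤_) ∣V∣≡k fewMissing)
  V∈Δ : V ∈Δ Δ
  V∈Δ = decidable-stable (T? (Δ V)) λ V∉Δ →
    <⇒≱ (count-pos (missing? V k Δ) (⊆-refl , ∣V∣≡k , V∉Δ)) nothing-missing

fewMissingFaces⇒vertexDecomposable : ∀ m → ∣ V ∣ ≡ m → FewMissingFaces V k Δ → VertexDecomposable Δ
fewMissingFaces⇒vertexDecomposable {k = zero} _ _ I = vertexDecomposable-rank0 I
fewMissingFaces⇒vertexDecomposable {k = suc k} m ∣V∣≡m I with m≤n⇒m<n∨m≡n (k≤∣V∣ I)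
... | inj₂ 1+k≡∣V∣ = vertexDecomposable-simplex I (sym 1+k≡∣V∣)
fewMissingFaces⇒vertexDecomposable {k = suc k} zero ∣V∣≡0 I | inj₁ 1+k<∣V∣ =
  contradiction (subst (suc k <_) ∣V∣≡0 1+k<∣V∣) λ ()
fewMissingFaces⇒vertexDecomposable {V = V} {k = suc k} {Δ = Δ} (suc m) ∣V∣≡1+m I | inj₁ 1+k<∣V∣
  with any? (λ x → x ∈? V ×-dec ¬? (T? (Δ ⁅ x ⁆)))
... | yes (x , x∈V , ⁅x⁆∉Δ) = fewMissingFaces⇒vertexDecomposable m (x∈p∧∣p∣≡1+m⇒∣p-x∣≡m x∈V ∣V∣≡1+m)
  (fewMissingFaces-removeNonVertex I (s≤s z≤n) x∈V ⁅x⁆∉Δ)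
... | no ∄ with ∃fewMissingFaces-del I (s≤s z≤n) 1+k<∣V∣
...   | x , x∈V , D = vd-shed x ⁅x⁆∈Δ (shedding I D)
          (fewMissingFaces⇒vertexDecomposable m ∣V-x∣≡m (fewMissingFaces-link I x∈V ⁅x⁆∈Δ))
          (fewMissingFaces⇒vertexDecomposable m ∣V-x∣≡m D)
  where
  ∣V-x∣≡m : ∣ V - x ∣ ≡ m
  ∣V-x∣≡m = x∈p∧∣p∣≡1+m⇒∣p-x∣≡m x∈V ∣V∣≡1+m
  ⁅x⁆∈Δ : ⁅ x ⁆ ∈Δ Δ
  ⁅x⁆∈Δ = decidable-stable (T? (Δ ⁅ x ⁆)) λ ⁅x⁆∉Δ → ∄ (x , x∈V , ⁅x⁆∉Δ)

≤-foldr-⊔ : ∀ {m xs} → m ∈ₗ xs → m ≤ foldr _⊔_ 0 xs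
≤-foldr-⊔ (Any.here refl)   = m≤m⊔n _ _
≤-foldr-⊔ (Any.there m∈xs) = m≤n⇒m≤o⊔n _ (≤-foldr-⊔ m∈xs)

≤-maxFaceSize : G ∈Δ Δ → ∣ G ∣ ≤ maxFaceSize Δ
≤-maxFaceSize {G = G} {Δ = Δ} G∈Δ = ≤-foldr-⊔ (∈-map⁺ ∣_∣ (∈-filter⁺ (T? ∘ Δ) (∈-allSubsets G) G∈Δ))

maxFaceSize≤n : ∀ {n} {Δ : Complex n} → maxFaceSize Δ ≤ n
maxFaceSize≤n {n = n} {Δ = Δ} =
  foldr-preservesᵇ {P = _≤ n} ⊔-lub z≤n (All.map⁺ (All.universal ∣p∣≤n (filter (T? ∘ Δ) (allSubsets n))))

∸≤⇒≤ : ∀ a b c → (b + a) ∸ c ≤ b → a ≤ c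
∸≤⇒≤ a b c b+a∸c≤b = +-cancelˡ-≤ b a c (begin
  b + a           ≤⟨ m≤n+m∸n (b + a) c ⟩
  c + (b + a ∸ c) ≤⟨ +-monoʳ-≤ c b+a∸c≤b ⟩
  c + b           ≡⟨ +-comm c b ⟩
  b + c           ∎)
  where open ≤-Reasoning

-- The k-subsets split into faces and missing sets, and the faces include the top facets.
#missing≤codim : ∀ {n} {Δ : Complex n} → (n C codim Δ) ∸ codim Δ ≤ numTopFacets Δ →
                 #missing ⊤ (maxFaceSize Δ) Δ ≤ codim Δ
#missing≤codim {n = n} {Δ = Δ} hyp = begin
  #missing ⊤ K Δ ≡⟨ count-cong (missing? ⊤ K Δ) missingK? (λ (_ , ∣G∣≡K , G∉Δ) → ∣G∣≡K , G∉Δ)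
                                                       (λ (∣G∣≡K , G∉Δ) → ⊆⊤ , ∣G∣≡K , G∉Δ) ⟩
  count missingK? ≤⟨ ∸≤⇒≤ (count missingK?) (count faceK?) (codim Δ) (begin
      (count faceK? + count missingK?) ∸ codim Δ ≡⟨ cong (_∸ codim Δ) (sym k-subsets) ⟩
      (n C codim Δ) ∸ codim Δ                      ≤⟨ hyp ⟩
      numTopFacets Δ                               ≤⟨ count-mono (T? ∘ topFacetᵇ) faceK? topFacet⇒faceK ⟩
      count faceK?                                 ∎) ⟩
  codim Δ ∎
  where
  open ≤-Reasoning
  K = maxFaceSize Δ
  topFacetᵇ : Subset n → Bool
  topFacetᵇ G = isFacetᵇ Δ G ∧ (∣ G ∣ ≡ᵇ K)
  faceK? = hasSize? K ∩? (T? ∘ Δ)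
  missingK? = hasSize? K ∩? ∁? (T? ∘ Δ)
  k-subsets : n C codim Δ ≡ count faceK? + count missingK?
  k-subsets = trans (sym (nCk≡nC[n∸k] (maxFaceSize≤n {Δ = Δ})))
                    (trans (sym (count-hasSize n K)) (count-split (hasSize? K) (T? ∘ Δ)))
  topFacet⇒faceK : T (topFacetᵇ G) → ∣ G ∣ ≡ K × G ∈Δ Δ
  topFacet⇒faceK {G = G} t =
    let (facet , size) = Equivalence.to T-∧ t in ≡ᵇ⇒≡ ∣ G ∣ K size , proj₁ (Equivalence.to T-∧ facet)

fewMissingFaces-top : ∀ {n} {Δ : Complex n} → IsSimplicialComplexOn n Δ →
                      (n C codim Δ) ∸ codim Δ ≤ numTopFacets Δ →
                      FewMissingFaces ⊤ (maxFaceSize Δ) Δ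
fewMissingFaces-top {n = n} {Δ = Δ} (downClosed , ∅∈Δ , _) hyp = record
  { downClosed = λ {F} {G} → downClosed F G
  ; ∅∈Δ        = ∅∈Δ
  ; faces⊆V    = λ _ → ⊆⊤
  ; faces≤k    = λ {G} → ≤-maxFaceSize {G = G} {Δ = Δ}
  ; fewMissing = subst (#missing ⊤ (maxFaceSize Δ) Δ + maxFaceSize Δ ≤_) (sym (∣⊤∣≡n n))
                       (m≤o∸n⇒m+n≤o _ (maxFaceSize≤n {Δ = Δ}) (#missing≤codim {Δ = Δ} hyp))
  }

corollary4p5 : (n : ℕ) (Δ : Complex n) → IsSimplicialComplexOn n Δ
    → (n C codim Δ) ∸ codim Δ ≤ numTopFacets Δ
    → VertexDecomposable Δ
corollary4p5 n Δ SC hyp = fewMissingFaces⇒vertexDecomposable n (∣⊤∣≡n n) (fewMissingFaces-top {Δ = Δ} SC hyp)
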